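{- Let $A=[a_{ij}]$ be an $n\times n$ matrix with $a_{ij}\ge 0$ real for all $i,j$. Let $r_i=\sum_j a_{ij}$ and $c_j=\sum_i a_{ij}$ denote the $i$-th row sum and $j$-th column sum. Then $$\sum_{i<j} r_i c_j \ \ge\ \frac12\Big(\sum_{i<j} a_{ij}\Big)^2 .$$ -}

module Defs where

open import Level using (Level; _⊔_)
open import Data.Nat using (ℕ)
import Data.Nat as ℕ
open import Data.Fin using (Fin; _<?_)
import Data.Fin as Fin
open import Data.Product using (∃)
open import Relation.Nullary using (¬_; does)
open import Data.Bool using (if_then_else_)
open import Algebra.Bundles using (CommutativeRing)
open import Relation.Binary.Structures using (IsTotalOrder)

-- An ordered field (the real numbers are the intended model):
-- a commutative ring with a total order compatible with + and *,
-- in which every nonzero element has a multiplicative inverse.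
record OrderedField c ℓ₁ ℓ₂ : Set (Level.suc (c ⊔ ℓ₁ ⊔ ℓ₂)) where
  field
    commutativeRing : CommutativeRing c ℓ₁
  open CommutativeRing commutativeRing public hiding (zero)
  infix 4 _≤_ _≥_
  field
    _≤_          : Carrier → Carrier → Set ℓ₂
    isTotalOrder : IsTotalOrder _≈_ _≤_
    +-mono-≤     : ∀ {x y} z → x ≤ y → x + z ≤ y + z
    *-nonneg     : ∀ {x y} → 0# ≤ x → 0# ≤ y → 0# ≤ x * y
    0≉1          : ¬ (0# ≈ 1#)
    inverse      : ∀ x → ¬ (x ≈ 0#) → ∃ λ y → x * y ≈ 1#

  _≥_ : Carrier → Carrier → Set ℓ₂
  x ≥ y = y ≤ x

  sumFin : (n : ℕ) → (Fin n → Carrier) → Carrier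
  sumFin ℕ.zero    f = 0#
  sumFin (ℕ.suc n) f = f Fin.zero + sumFin n (λ i → f (Fin.suc i))

  sumLt : (n : ℕ) → (Fin n → Fin n → Carrier) → Carrier
  sumLt n g = sumFin n λ i → sumFin n λ j → if does (i <? j) then g i j else 0#

  rowSum : (n : ℕ) → (Fin n → Fin n → Carrier) → Fin n → Carrier
  rowSum n a i = sumFin n λ j → a i j

  colSum : (n : ℕ) → (Fin n → Fin n → Carrier) → Fin n → Carrier
  colSum n a j = sumFin n λ i → a i j

-- Expanding both sides over quadruples of indices, the square of Σ_{i<k} a_ik is
-- Σ a_ik a_lj over all (i,k,l,j) with i < k and l < j, and Σ_{i<j} r_i c_j is
-- Σ a_ik a_lj over all (i,k,l,j) with i < j.  If i < k and l < j then i < j or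
-- l < k (otherwise l < j ≤ i < k ≤ l), so each term of the square is dominated
-- by a term indexed by (i,k,l,j) or by (l,j,i,k) in the second sum; as all terms
-- are nonnegative, the square is at most twice Σ_{i<j} r_i c_j.
module Submission where

open import Defs
open import Data.Nat using (ℕ; zero; suc)
import Data.Nat.Properties as ℕ
open import Data.Fin using (Fin; _<_; _<?_)
import Data.Fin as Fin
open import Data.Bool using (true; false; if_then_else_)
open import Data.Sum using (_⊎_; inj₁; inj₂)
import Data.Sum as Sum
open import Function using (_∘_)
open import Relation.Nullary using (Dec; does; yes; no)
open import Data.Empty using (⊥-elim)
open import Relation.Binary.Bundles using (Poset)
open import Relation.Binary.Structures using (IsTotalOrder)
import Relation.Binary.PropositionalEquality as ≡
open ≡ using (_≡_)
import Algebra.Properties.AbelianGroup as AbelianGroupProperties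
import Algebra.Properties.CommutativeSemigroup as CommutativeSemigroupProperties
import Algebra.Properties.Ring as RingProperties
import Algebra.Properties.Semiring.Sum as SemiringSum
import Relation.Binary.Reasoning.PartialOrder as PosetReasoning

<-crossing : ∀ {n} {i j k l : Fin n} → i < k → l < j → i < j ⊎ l < k
<-crossing {i = i} {j} i<k l<j with i <? j
... | yes i<j = inj₁ i<j
... | no  i≮j = inj₂ (ℕ.<-trans (ℕ.<-≤-trans l<j (ℕ.≮⇒≥ i≮j)) i<k)

module OrderedFieldProperties {c ℓ₁ ℓ₂} (F : OrderedField c ℓ₁ ℓ₂) where
  open OrderedField F
  open IsTotalOrder isTotalOrder public using (total) renaming (refl to ≤-refl)
  open RingProperties ring using (-‿distribˡ-*; -‿distribʳ-*; -‿involutive)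
  open AbelianGroupProperties +-abelianGroup using (xyx⁻¹≈y)
  open CommutativeSemigroupProperties *-commutativeSemigroup using (x∙yz≈y∙xz)

  poset : Poset c ℓ₁ ℓ₂
  poset = record { isPartialOrder = IsTotalOrder.isPartialOrder isTotalOrder }

  open PosetReasoning poset

  +-mono₂-≤ : ∀ {x y u v} → x ≤ y → u ≤ v → x + u ≤ y + v
  +-mono₂-≤ {x} {y} {u} {v} x≤y u≤v = begin
    x + u  ≤⟨ +-mono-≤ u x≤y ⟩
    y + u  ≈⟨ +-comm y u ⟩
    u + y  ≤⟨ +-mono-≤ y u≤v ⟩
    v + y  ≈⟨ +-comm v y ⟩
    y + v  ∎

  x≤x+y : ∀ x {y} → 0# ≤ y → x ≤ x + y
  x≤x+y x {y} 0≤y = begin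
    x       ≈⟨ +-identityʳ x ⟨
    x + 0#  ≤⟨ +-mono₂-≤ ≤-refl 0≤y ⟩
    x + y   ∎

  x≤y+x : ∀ x {y} → 0# ≤ y → x ≤ y + x
  x≤y+x x {y} 0≤y = begin
    x      ≤⟨ x≤x+y x 0≤y ⟩
    x + y  ≈⟨ +-comm x y ⟩
    y + x  ∎

  +-nonneg : ∀ {x y} → 0# ≤ x → 0# ≤ y → 0# ≤ x + y
  +-nonneg {x} 0≤x 0≤y = begin
    0#     ≤⟨ 0≤x ⟩
    x      ≤⟨ x≤x+y x 0≤y ⟩
    _      ∎

  x≤y⇒0≤y-x : ∀ {x y} → x ≤ y → 0# ≤ y - x
  x≤y⇒0≤y-x {x} {y} x≤y = begin
    0#     ≈⟨ -‿inverseʳ x ⟨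
    x - x  ≤⟨ +-mono-≤ (- x) x≤y ⟩
    y - x  ∎

  0≤x*x : ∀ x → 0# ≤ x * x
  0≤x*x x with total 0# x
  ... | inj₁ 0≤x = *-nonneg 0≤x 0≤x
  ... | inj₂ x≤0 = begin
    0#           ≤⟨ *-nonneg 0≤-x 0≤-x ⟩
    - x * - x    ≈⟨ -‿distribˡ-* x (- x) ⟨
    - (x * - x)  ≈⟨ -‿cong (-‿distribʳ-* x x) ⟨
    - - (x * x)  ≈⟨ -‿involutive (x * x) ⟩
    x * x        ∎
    where
    0≤-x : 0# ≤ - x
    0≤-x = begin
      0#      ≤⟨ x≤y⇒0≤y-x x≤0 ⟩
      0# - x  ≈⟨ +-identityˡ (- x) ⟩
      - x     ∎

  0≤1 : 0# ≤ 1#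
  0≤1 = begin
    0#       ≤⟨ 0≤x*x 1# ⟩
    1# * 1#  ≈⟨ *-identityˡ 1# ⟩
    1#       ∎

  -- h = h · (2h) = 2 h², a nonnegative multiple of a square.
  0≤half : ∀ {h} → (1# + 1#) * h ≈ 1# → 0# ≤ h
  0≤half {h} 2h≈1 = begin
    0#                   ≤⟨ *-nonneg (+-nonneg 0≤1 0≤1) (0≤x*x h) ⟩
    (1# + 1#) * (h * h)  ≈⟨ x∙yz≈y∙xz h (1# + 1#) h ⟨
    h * ((1# + 1#) * h)  ≈⟨ *-congˡ 2h≈1 ⟩
    h * 1#               ≈⟨ *-identityʳ h ⟩
    h                    ∎

  *-monoˡ-≤-nonneg : ∀ {h x y} → 0# ≤ h → x ≤ y → h * x ≤ h * y
  *-monoˡ-≤-nonneg {h} {x} {y} 0≤h x≤y = begin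
    h * x                  ≈⟨ +-identityʳ (h * x) ⟨
    h * x + 0#             ≤⟨ +-mono₂-≤ ≤-refl (*-nonneg 0≤h (x≤y⇒0≤y-x x≤y)) ⟩
    h * x + h * (y - x)    ≈⟨ distribˡ h x (y - x) ⟨
    h * (x + (y - x))      ≈⟨ *-congˡ (+-assoc x y (- x)) ⟨
    h * (x + y - x)        ≈⟨ *-congˡ (xyx⁻¹≈y x y) ⟩
    h * y                  ∎

  half*[x+x]≈x : ∀ {h} → (1# + 1#) * h ≈ 1# → ∀ x → h * (x + x) ≈ x
  half*[x+x]≈x {h} 2h≈1 x = begin-equality
    h * (x + x)            ≈⟨ *-congˡ (+-cong (*-identityˡ x) (*-identityˡ x)) ⟨
    h * (1# * x + 1# * x)  ≈⟨ *-congˡ (distribʳ x 1# 1#) ⟨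
    h * ((1# + 1#) * x)    ≈⟨ *-assoc h (1# + 1#) x ⟨
    h * (1# + 1#) * x      ≈⟨ *-congʳ (trans (*-comm h (1# + 1#)) 2h≈1) ⟩
    1# * x                 ≈⟨ *-identityˡ x ⟩
    x                      ∎

  if-nonneg : ∀ b {x} → 0# ≤ x → 0# ≤ (if b then x else 0#)
  if-nonneg true  0≤x = 0≤x
  if-nonneg false 0≤x = ≤-refl

  if-*-if-≤ : ∀ {p} {P Q R S : Set p} (P? : Dec P) (Q? : Dec Q) (R? : Dec R) (S? : Dec S) {x y} →
              0# ≤ x → 0# ≤ y → (P → Q → R ⊎ S) →
              (if does P? then x else 0#) * (if does Q? then y else 0#)
                ≤ (if does R? then x * y else 0#) + (if does S? then y * x else 0#)
  if-*-if-≤ (no _) Q? R? S? 0≤x 0≤y _ = begin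
    0# * _  ≈⟨ zeroˡ _ ⟩
    0#      ≤⟨ +-nonneg (if-nonneg (does R?) (*-nonneg 0≤x 0≤y)) (if-nonneg (does S?) (*-nonneg 0≤y 0≤x)) ⟩
    _       ∎
  if-*-if-≤ (yes _) (no _) R? S? {x} 0≤x 0≤y _ = begin
    x * 0#  ≈⟨ zeroʳ x ⟩
    0#      ≤⟨ +-nonneg (if-nonneg (does R?) (*-nonneg 0≤x 0≤y)) (if-nonneg (does S?) (*-nonneg 0≤y 0≤x)) ⟩
    _       ∎
  if-*-if-≤ (yes _) (yes _) (yes _) S? {x} {y} 0≤x 0≤y _ = x≤x+y (x * y) (if-nonneg (does S?) (*-nonneg 0≤y 0≤x))
  if-*-if-≤ (yes _) (yes _) (no _) (yes _) {x} {y} 0≤x 0≤y _ = begin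
    x * y       ≈⟨ *-comm x y ⟩
    y * x       ≤⟨ x≤y+x (y * x) ≤-refl ⟩
    0# + y * x  ∎
  if-*-if-≤ (yes p) (yes q) (no ¬r) (no ¬s) 0≤x 0≤y P→Q→R⊎S = ⊥-elim (Sum.[ ¬r , ¬s ] (P→Q→R⊎S p q))

module SumProperties {c ℓ₁ ℓ₂} (F : OrderedField c ℓ₁ ℓ₂) where
  open OrderedField F
  open OrderedFieldProperties F
  open SemiringSum semiring
  open PosetReasoning poset

  ∑-mono-≤ : ∀ {n} {f g : Fin n → Carrier} → (∀ i → f i ≤ g i) → ∑[ i < n ] f i ≤ ∑[ i < n ] g i
  ∑-mono-≤ {zero}  f≤g = ≤-refl
  ∑-mono-≤ {suc n} f≤g = +-mono₂-≤ (f≤g Fin.zero) (∑-mono-≤ (f≤g ∘ Fin.suc))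

  ∑-*-∑ : ∀ {m n} (f : Fin m → Carrier) (g : Fin n → Carrier) →
          (∑[ i < m ] f i) * (∑[ j < n ] g j) ≈ ∑[ i < m ] ∑[ j < n ] (f i * g j)
  ∑-*-∑ f g = trans (*-distribʳ-sum _ f) (sum-cong-≋ λ i → *-distribˡ-sum (f i) g)

  sumFin≡∑ : ∀ n (f : Fin n → Carrier) → sumFin n f ≡ ∑[ i < n ] f i
  sumFin≡∑ zero    f = ≡.refl
  sumFin≡∑ (suc n) f = ≡.cong (f Fin.zero +_) (sumFin≡∑ n (f ∘ Fin.suc))

  ∑² : ∀ {m n} → (Fin m → Fin n → Carrier) → Carrier
  ∑² {m} {n} f = ∑[ i < m ] ∑[ j < n ] f i j

  sumFin²≡∑² : ∀ m n (f : Fin m → Fin n → Carrier) → sumFin m (λ i → sumFin n (f i)) ≡ ∑² f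
  sumFin²≡∑² m n f = ≡.trans (sumFin≡∑ m _) (sum-cong-≗ λ i → sumFin≡∑ n (f i))

  ∑²-cong : ∀ {m n} {f g : Fin m → Fin n → Carrier} → (∀ i j → f i j ≈ g i j) → ∑² f ≈ ∑² g
  ∑²-cong f≈g = sum-cong-≋ λ i → sum-cong-≋ (f≈g i)

  ∑²-mono-≤ : ∀ {m n} {f g : Fin m → Fin n → Carrier} → (∀ i j → f i j ≤ g i j) → ∑² f ≤ ∑² g
  ∑²-mono-≤ f≤g = ∑-mono-≤ λ i → ∑-mono-≤ (f≤g i)

  ∑²-distrib-+ : ∀ {m n} (f g : Fin m → Fin n → Carrier) →
                 ∑² (λ i j → f i j + g i j) ≈ ∑² f + ∑² g
  ∑²-distrib-+ f g = trans (sum-cong-≋ λ i → ∑-distrib-+ (f i) (g i)) (∑-distrib-+ (sum ∘ f) (sum ∘ g))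

  ∑²-zero : ∀ m n → ∑² {m} {n} (λ _ _ → 0#) ≈ 0#
  ∑²-zero m n = trans (sum-cong-≋ {m} {y = λ _ → 0#} λ _ → sum-replicate-zero n) (sum-replicate-zero m)

  ∑²-comm : ∀ {m n p q} (f : Fin m → Fin n → Fin p → Fin q → Carrier) →
            ∑² (λ i k → ∑² (λ l j → f i k l j)) ≈ ∑² (λ l j → ∑² (λ i k → f i k l j))
  ∑²-comm {m} {n} {p} {q} f = begin-equality
    (∑[ i < m ] ∑[ k < n ] ∑[ l < p ] ∑[ j < q ] f i k l j)  ≈⟨ sum-cong-≋ {m} (λ i → ∑-comm {n} {p} _) ⟩
    (∑[ i < m ] ∑[ l < p ] ∑[ k < n ] ∑[ j < q ] f i k l j)  ≈⟨ ∑-comm {m} {p} _ ⟩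
    (∑[ l < p ] ∑[ i < m ] ∑[ k < n ] ∑[ j < q ] f i k l j)  ≈⟨ sum-cong-≋ {p} (λ l → sum-cong-≋ {m} λ i → ∑-comm {n} {q} _) ⟩
    (∑[ l < p ] ∑[ i < m ] ∑[ j < q ] ∑[ k < n ] f i k l j)  ≈⟨ sum-cong-≋ {p} (λ l → ∑-comm {m} {q} _) ⟩
    (∑[ l < p ] ∑[ j < q ] ∑[ i < m ] ∑[ k < n ] f i k l j)  ∎

  ∑²-*-∑² : ∀ {m n p q} (f : Fin m → Fin n → Carrier) (g : Fin p → Fin q → Carrier) →
            ∑² f * ∑² g ≈ ∑² (λ i k → ∑² (λ l j → f i k * g l j))
  ∑²-*-∑² {m} {n} {p} {q} f g = begin-equality
    ∑² f * ∑² g                                              ≈⟨ ∑-*-∑ (sum ∘ f) (sum ∘ g) ⟩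
    ∑² (λ i l → sum (f i) * sum (g l))                       ≈⟨ ∑²-cong (λ i l → ∑-*-∑ (f i) (g l)) ⟩
    (∑[ i < m ] ∑[ l < p ] ∑[ k < n ] ∑[ j < q ] (f i k * g l j))  ≈⟨ sum-cong-≋ {m} (λ i → ∑-comm {p} {n} _) ⟩
    ∑² (λ i k → ∑² (λ l j → f i k * g l j))                  ∎

  if-*-sumFin : ∀ b m n (f : Fin m → Carrier) (g : Fin n → Carrier) →
                (if b then sumFin m f * sumFin n g else 0#) ≈ ∑² (λ k l → if b then f k * g l else 0#)
  if-*-sumFin true  m n f g = trans (*-cong (reflexive (sumFin≡∑ m f)) (reflexive (sumFin≡∑ n g))) (∑-*-∑ f g)
  if-*-sumFin false m n f g = sym (∑²-zero m n)

  sumLt²≤2sumLt[rowSum*colSum] : ∀ n (a : Fin n → Fin n → Carrier) → (∀ i j → 0# ≤ a i j) →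
    sumLt n a * sumLt n a ≤ sumLt n (λ i j → rowSum n a i * colSum n a j)
                            + sumLt n (λ i j → rowSum n a i * colSum n a j)
  sumLt²≤2sumLt[rowSum*colSum] n a 0≤a = begin
    S * S                                          ≈⟨ *-cong S≈∑²u S≈∑²u ⟩
    ∑² u * ∑² u                                    ≈⟨ ∑²-*-∑² u u ⟩
    ∑² (λ i k → ∑² λ l j → u i k * u l j)          ≤⟨ ∑²-mono-≤ {n} {n} (λ i k → ∑²-mono-≤ {n} {n} λ l j → u*u≤w+w i k l j) ⟩
    ∑² (λ i k → ∑² λ l j → w i k l j + w l j i k)  ≈⟨ ∑²-cong {n} {n} (λ i k → ∑²-distrib-+ {n} {n} _ _) ⟩
    ∑² (λ i k → ∑² (w i k) + ∑² λ l j → w l j i k) ≈⟨ ∑²-distrib-+ {n} {n} _ _ ⟩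
    W + ∑² (λ i k → ∑² λ l j → w l j i k)          ≈⟨ +-congˡ (∑²-comm (λ i k l j → w l j i k)) ⟩
    W + W                                          ≈⟨ +-cong L≈W L≈W ⟨
    L + L                                          ∎
    where
    S L W : Carrier
    S = sumLt n a
    L = sumLt n (λ i j → rowSum n a i * colSum n a j)

    u : Fin n → Fin n → Carrier
    u i k = if does (i <? k) then a i k else 0#

    w : Fin n → Fin n → Fin n → Fin n → Carrier
    w i k l j = if does (i <? j) then a i k * a l j else 0#

    W = ∑² (λ i k → ∑² λ l j → w i k l j)

    u*u≤w+w : ∀ i k l j → u i k * u l j ≤ w i k l j + w l j i k
    u*u≤w+w i k l j = if-*-if-≤ (i <? k) (l <? j) (i <? j) (l <? k) (0≤a i k) (0≤a l j) <-crossing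

    S≈∑²u : S ≈ ∑² u
    S≈∑²u = reflexive (sumFin²≡∑² n n u)

    L≈W : L ≈ W
    L≈W = begin-equality
      L                                                        ≡⟨ sumFin²≡∑² n n _ ⟩
      ∑² (λ i j → if does (i <? j) then rowSum n a i * colSum n a j else 0#)
          ≈⟨ ∑²-cong (λ i j → if-*-sumFin (does (i <? j)) n n (a i) (λ l → a l j)) ⟩
      (∑[ i < n ] ∑[ j < n ] ∑[ k < n ] ∑[ l < n ] w i k l j)  ≈⟨ sum-cong-≋ {n} (λ i → ∑-comm {n} {n} _) ⟩
      (∑[ i < n ] ∑[ k < n ] ∑[ j < n ] ∑[ l < n ] w i k l j)  ≈⟨ sum-cong-≋ {n} (λ i → sum-cong-≋ {n} λ k → ∑-comm {n} {n} _) ⟩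
      W                                                        ∎

lemma4 : ∀ {c ℓ₁ ℓ₂} (F : OrderedField c ℓ₁ ℓ₂) → let open OrderedField F in
         (n : ℕ) (a : Fin n → Fin n → Carrier) → (∀ i j → 0# ≤ a i j) →
         (half : Carrier) → (1# + 1#) * half ≈ 1# →
         sumLt n (λ i j → rowSum n a i * colSum n a j) ≥ half * (sumLt n a * sumLt n a)
lemma4 F n a 0≤a half 2half≈1 = begin
  half * (S * S)  ≤⟨ *-monoˡ-≤-nonneg (0≤half 2half≈1) (sumLt²≤2sumLt[rowSum*colSum] n a 0≤a) ⟩
  half * (L + L)  ≈⟨ half*[x+x]≈x 2half≈1 L ⟩
  L               ∎
  where
  open OrderedField F
  open OrderedFieldProperties F
  open SumProperties F
  open PosetReasoning poset
  S L : Carrier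
  S = sumLt n a
  L = sumLt n (λ i j → rowSum n a i * colSum n a j)
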